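{- Fix a finite set $N=\{p_1,\dots,p_n\}$ of propositional variables. The logic $\mathbf{PL}(=\!(\cdot),\subseteq)$ (classical propositional logic extended with dependence atoms and inclusion atoms, with full negation) is expressively complete for the class of all team properties over $N$ that contain the empty team. That is: (1) for every $\mathbf{PL}(=\!(\cdot),\subseteq)$-formula $\phi$ with propositional variables from $N$, $\emptyset\in[\![\phi]\!]$; and (2) for every set $T\subseteq\wp(2^N)$ with $\emptyset\in T$ there is a $\mathbf{PL}(=\!(\cdot),\subseteq)$-formula $\phi$ with propositional variables from $N$ such that $[\![\phi]\!]=T$.
   Context: A valuation is a map $v$ from propositional variables to $\{0,1\}$; an $N$-team is a set $t\subseteq 2^N$ of valuations $v:N\to\{0,1\}$. Formulas of $\mathbf{PL}(=\!(\cdot),\subseteq)$ are built by: $\phi::= p\mid\bot\mid =\!(p_1\dots p_m,q)\mid a_1\dots a_m\subseteq b_1\dots b_m\mid\neg\phi\mid\phi\wedge\phi\mid\phi\vee\phi$, where $p,p_i,q$ are propositional variables and $a_i,b_i$ are propositional variables or one of the constants $\top,\bot$. Team semantics: $t\models p$ iff $v(p)=1$ for all $v\in t$; $t\models\bot$ iff $t=\emptyset$; $t\models\neg\phi$ iff $\{v\}\not\models\phi$ for all $v\in t$; $t\models\phi\wedge\psi$ iff $t\models\phi$ and $t\models\psi$; $t\models\phi\vee\psi$ iff there are $r,s\subseteq t$ with $t=r\cup s$, $r\models\phi$, $s\models\psi$; $t\models =\!(p_1\dots p_m,q)$ iff for all $v,u\in t$, if $v(p_i)=u(p_i)$ for all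 $i$ then $v(q)=u(q)$; $t\models a_1\dots a_m\subseteq b_1\dots b_m$ iff for every $v\in t$ there is $u\in t$ with $v(a_i)=u(b_i)$ for all $i$ (where $v(\top)=1$, $v(\bot)=0$ for every valuation $v$). A team property over $N$ is a set $T\subseteq\wp(2^N)$ of $N$-teams, and for a formula $\phi$ with variables from $N$, $[\![\phi]\!]=\{t\subseteq 2^N: t\models\phi\}$. -}

module Defs where

open import Data.Nat using (ℕ)
open import Data.Bool using (Bool; true; false; _∨_)
open import Data.Fin using (Fin)
open import Data.Vec using (Vec; lookup; map)
open import Data.Vec.Properties using (≡-dec)
open import Data.Bool.Properties using () renaming (_≟_ to _≟B_)
open import Data.List using (List)
open import Data.List.Relation.Unary.All using (All)
open import Data.Product using (Σ; _×_; ∃)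
open import Relation.Binary.PropositionalEquality using (_≡_)
open import Relation.Nullary using (¬_)
open import Relation.Nullary.Decidable using (⌊_⌋)

-- A valuation of the variables N = {p_0,…,p_{n-1}} (represented by Fin n).
Valuation : ℕ → Set
Valuation n = Vec Bool n

Team : ℕ → Set
Team n = Valuation n → Bool

emptyTeam : ∀ {n} → Team n
emptyTeam _ = false

singleton : ∀ {n} → Valuation n → Team n
singleton v u = ⌊ ≡-dec _≟B_ u v ⌋

_≐_ : ∀ {n} → Team n → Team n → Set
t ≐ s = ∀ v → t v ≡ s v

-- A team property: a set of teams, as a characteristic function,
-- required to be extensional (it only depends on the set of valuations).
Extensional : ∀ {n} → (Team n → Bool) → Set
Extensional {n} T = ∀ (t s : Team n) → t ≐ s → T t ≡ T s

data Term (n : ℕ) : Set where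
  var  : Fin n → Term n
  ttop : Term n
  tbot : Term n

evalT : ∀ {n} → Valuation n → Term n → Bool
evalT v (var i) = lookup v i
evalT v ttop = true
evalT v tbot = false

data Form (n : ℕ) : Set where
  atom : Fin n → Form n
  falsum : Form n
  dep : List (Fin n) → Fin n → Form n
  incl : ∀ {m} → Vec (Term n) m → Vec (Term n) m → Form n
  neg : Form n → Form n
  _∧f_ : Form n → Form n → Form n
  _∨f_ : Form n → Form n → Form n

_⊨_ : ∀ {n} → Team n → Form n → Set
t ⊨ atom p = ∀ v → t v ≡ true → lookup v p ≡ true
t ⊨ falsum = ∀ v → t v ≡ false
t ⊨ dep ps q = ∀ v u → t v ≡ true → t u ≡ true →
  All (λ p → lookup v p ≡ lookup u p) ps → lookup v q ≡ lookup u q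
t ⊨ incl as bs = ∀ v → t v ≡ true →
  ∃ λ u → t u ≡ true × map (evalT v) as ≡ map (evalT u) bs
t ⊨ neg φ = ∀ v → t v ≡ true → ¬ (singleton v ⊨ φ)
t ⊨ (φ ∧f ψ) = (t ⊨ φ) × (t ⊨ ψ)
t ⊨ (φ ∨f ψ) = Σ (Team _) λ r → Σ (Team _) λ s →
  (∀ v → t v ≡ (r v ∨ s v)) × (r ⊨ φ) × (s ⊨ ψ)

module Submission where

-- Conversely, the
-- constancy atoms =(pᵢ) make "at most k valuations" expressible as a k-fold team
-- disjunction, and an inclusion atom whose left-hand side is the constant tuple w says
-- "w is in the team, unless the team is empty".  Hence, for a nonempty team t₀,
--   distinguish t₀ = (at most |t₀| - 1 valuations) ∨ (meets the complement of t₀)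
-- holds exactly in the teams s ≠ t₀: a proper subteam of t₀ is smaller, every other s ≠ t₀
-- meets the complement, while a split of t₀ itself must put all of t₀ into the first
-- disjunct.  A property T with ∅ ∈ T is defined by the conjunction of distinguish t₀ over
-- the finitely many teams t₀ ∉ T.

open import Defs
open import Data.Nat using (ℕ; zero; suc; pred; _+_; _≤_; _<_; z≤n; s≤s)
open import Data.Nat.Properties using (+-commutativeSemigroup; ≤-refl; ≤-reflexive; ≤-trans; <-≤-trans; ≤-pred; +-mono-≤; +-mono-≤-<; m+n≡0⇒m≡0; m+n≡0⇒n≡0; n≤0⇒n≡0; 1+n≰n; <⇒≤pred)
open import Algebra.Properties.CommutativeSemigroup +-commutativeSemigroup using (interchange)
open import Data.Bool using (Bool; true; false; _∨_; _∧_; not; if_then_else_)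
open import Data.Bool.Properties using (¬-not; not-¬; ⇔→≡; ∨-identityʳ; ∨-zeroʳ; ∨-inverseʳ; ∧-identityʳ; ∧-zeroʳ; ∧-distribˡ-∨) renaming (_≟_ to _≟B_)
open import Data.Vec using (Vec; []; _∷_; lookup; tabulate) renaming (map to vmap)
open import Data.Vec.Properties using (≡-dec; ∷-injective; map-∘; map-id; map-cong; tabulate-∘; tabulate∘lookup; tabulate-cong)
open import Data.List using (List; []; _∷_; map; filter; allFin; cartesianProductWith)
open import Data.List.Membership.Propositional using (_∈_; lose)
open import Data.List.Membership.Propositional.Properties using (∈-filter⁺; ∈-filter⁻; ∈-allFin; ∈-cartesianProductWith⁺)
open import Data.List.Relation.Unary.All as All using (All; []; _∷_)
open import Data.List.Relation.Unary.All.Properties using (map⁺; map⁻; all-filter)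
open import Data.List.Relation.Unary.Any using (here; there; any?; satisfied)
open import Data.List.Relation.Unary.AllPairs using ([]; _∷_)
open import Data.List.Relation.Unary.Unique.Propositional using (Unique)
open import Data.List.Relation.Unary.Unique.Propositional.Properties using (cartesianProductWith⁺)
open import Data.Product using (_×_; ∃; _,_; proj₂)
open import Data.Sum using (_⊎_; inj₁; inj₂)
open import Relation.Binary.PropositionalEquality using (_≡_; _≢_; refl; sym; trans; cong; subst; module ≡-Reasoning)
open import Relation.Nullary using (¬_; Dec; yes; no; contradiction)
open import Relation.Nullary.Decidable using (⌊_⌋; _×-dec_)
open import Relation.Unary using (Decidable)
open import Function using (_∘_; id)
open import Function.Bundles using (_⇔_; mk⇔; Equivalence)

n≤pred[n]⇒n≡0 : ∀ {n} → n ≤ pred n → n ≡ 0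
n≤pred[n]⇒n≡0 {zero} _ = refl
n≤pred[n]⇒n≡0 {suc n} 1+n≤n = contradiction 1+n≤n 1+n≰n

-- Finite sets as boolean predicates

module _ {A : Set} where

  infix 4 _⊆_
  infixr 6 _∪_ _∩_ _∖_

  _⊆_ : (A → Bool) → (A → Bool) → Set
  p ⊆ q = ∀ x → p x ≡ true → q x ≡ true

  _∪_ _∩_ _∖_ : (A → Bool) → (A → Bool) → A → Bool
  (p ∪ q) x = p x ∨ q x
  (p ∩ q) x = p x ∧ q x
  (p ∖ q) x = p x ∧ not (q x)

  ∩∪∖ : (p q : A → Bool) (x : A) → p x ≡ ((p ∩ q) ∪ (p ∖ q)) x
  ∩∪∖ p q x = begin
    p x                          ≡⟨ ∧-identityʳ (p x) ⟨
    p x ∧ true                   ≡⟨ cong (p x ∧_) (∨-inverseʳ (q x)) ⟨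
    p x ∧ (q x ∨ not (q x))      ≡⟨ ∧-distribˡ-∨ (p x) (q x) (not (q x)) ⟩
    ((p ∩ q) ∪ (p ∖ q)) x        ∎
    where open ≡-Reasoning

  ⊆-∪ˡ : (p q : A → Bool) → p ⊆ p ∪ q
  ⊆-∪ˡ p q x px rewrite px = refl

  ⊆-∪ʳ : (p q : A → Bool) → q ⊆ p ∪ q
  ⊆-∪ʳ p q x qx rewrite qx = ∨-zeroʳ (p x)

  ∪-cases : (p q : A → Bool) (x : A) → (p ∪ q) x ≡ true → p x ≡ true ⊎ q x ≡ true
  ∪-cases p q x p∨q with p x
  ... | true = inj₁ refl
  ... | false = inj₂ p∨q

  ∩-⊆ʳ : (p q : A → Bool) → p ∩ q ⊆ q
  ∩-⊆ʳ p q x p∧q with p x | p∧q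
  ... | true | qx = qx

  ∖-⊆ : (p q : A → Bool) → p ∖ q ⊆ p
  ∖-⊆ p q x p∖q with p x | p∖q
  ... | true | _ = refl

  bit : Bool → ℕ
  bit true = 1
  bit false = 0

  count : (A → Bool) → List A → ℕ
  count p [] = 0
  count p (x ∷ xs) = bit (p x) + count p xs

  bit-mono : ∀ {a b} → (a ≡ true → b ≡ true) → bit a ≤ bit b
  bit-mono {false} _ = z≤n
  bit-mono {true} a⇒b rewrite a⇒b refl = ≤-refl

  bit-∨ : ∀ {a b c} → (a ≡ true → b ∨ c ≡ true) → bit a ≤ bit b + bit c
  bit-∨ {false} _ = z≤n
  bit-∨ {true} {true} _ = s≤s z≤n
  bit-∨ {true} {false} a⇒c rewrite a⇒c refl = ≤-refl

  count-mono : ∀ {p q} → p ⊆ q → ∀ xs → count p xs ≤ count q xs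
  count-mono p⊆q [] = z≤n
  count-mono p⊆q (x ∷ xs) = +-mono-≤ (bit-mono (p⊆q x)) (count-mono p⊆q xs)

  count-strict : ∀ {p q x xs} → p ⊆ q → x ∈ xs → p x ≡ false → q x ≡ true →
    count p xs < count q xs
  count-strict {xs = _ ∷ xs} p⊆q (here refl) px qx rewrite px | qx = s≤s (count-mono p⊆q xs)
  count-strict {x = y} {xs = x ∷ _} p⊆q (there y∈xs) px qx =
    +-mono-≤-< (bit-mono (p⊆q x)) (count-strict p⊆q y∈xs px qx)

  count-∪ : ∀ {p q r} → p ⊆ q ∪ r → ∀ xs → count p xs ≤ count q xs + count r xs
  count-∪ p⊆q∪r [] = z≤n
  count-∪ {p} {q} {r} p⊆q∪r (x ∷ xs) = ≤-trans
    (+-mono-≤ (bit-∨ {p x} {q x} {r x} (p⊆q∪r x)) (count-∪ {p} {q} {r} p⊆q∪r xs))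
    (≤-reflexive (interchange (bit (q x)) (bit (r x)) (count q xs) (count r xs)))

  count-zero : ∀ {p x xs} → count p xs ≡ 0 → x ∈ xs → p x ≡ false
  count-zero {p} {xs = x ∷ xs} c≡0 (here refl) with p x | m+n≡0⇒m≡0 (bit (p x)) c≡0
  ... | false | _ = refl
  count-zero {p} {xs = x ∷ xs} c≡0 (there y∈xs) = count-zero (m+n≡0⇒n≡0 (bit (p x)) c≡0) y∈xs

  count-none : ∀ {p} xs → (∀ {x} → x ∈ xs → p x ≡ false) → count p xs ≡ 0
  count-none [] _ = refl
  count-none (x ∷ xs) none rewrite none (here refl) = count-none xs (λ y∈xs → none (there y∈xs))

  count-unique : ∀ {p xs} → Unique xs → (∀ x y → p x ≡ true → p y ≡ true → x ≡ y) →
    count p xs ≤ 1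
  count-unique {xs = []} _ _ = z≤n
  count-unique {p} {x ∷ xs} (x∉xs ∷ unique) p-unique with p x in px
  ... | false = count-unique unique p-unique
  ... | true = s≤s (≤-reflexive (count-none xs λ {y} y∈xs →
    ¬-not λ py → All.lookup x∉xs y∈xs (p-unique x y px py)))

-- Valuations and teams

bools : List Bool
bools = true ∷ false ∷ []

∈-bools : (b : Bool) → b ∈ bools
∈-bools true = here refl
∈-bools false = there (here refl)

valuations : (n : ℕ) → List (Valuation n)
valuations zero = [] ∷ []
valuations (suc n) = cartesianProductWith _∷_ bools (valuations n)

∈-valuations : ∀ {n} (v : Valuation n) → v ∈ valuations n
∈-valuations [] = here refl
∈-valuations (b ∷ v) = ∈-cartesianProductWith⁺ _∷_ (∈-bools b) (∈-valuations v)

valuations-unique : ∀ n → Unique (valuations n)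
valuations-unique zero = [] ∷ []
valuations-unique (suc n) =
  cartesianProductWith⁺ _∷_ ∷-injective (((λ ()) ∷ []) ∷ [] ∷ []) (valuations-unique n)

module _ {n : ℕ} where

  _≟ᵥ_ : (u v : Valuation n) → Dec (u ≡ v)
  _≟ᵥ_ = ≡-dec _≟B_

  lookup-ext : ∀ {u v : Valuation n} → (∀ i → lookup u i ≡ lookup v i) → u ≡ v
  lookup-ext {u} {v} u≗v = begin
    u                    ≡⟨ tabulate∘lookup u ⟨
    tabulate (lookup u)  ≡⟨ tabulate-cong u≗v ⟩
    tabulate (lookup v)  ≡⟨ tabulate∘lookup v ⟩
    v                    ∎
    where open ≡-Reasoning

  singleton-self : (v : Valuation n) → singleton v v ≡ true
  singleton-self v with v ≟ᵥ v
  ... | yes _ = refl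
  ... | no v≢v = contradiction refl v≢v

  singleton-≡ : ∀ {w v : Valuation n} → singleton w v ≡ true → v ≡ w
  singleton-≡ {w} {v} _ with v ≟ᵥ w
  ... | yes v≡w = v≡w

  any-valuation? : {P : Valuation n → Set} → Decidable P → Dec (∃ P)
  any-valuation? P? with any? P? (valuations n)
  ... | yes some = yes (satisfied some)
  ... | no none = no λ (v , Pv) → none (lose (∈-valuations v) Pv)

  ⊆-or-witness : (s t : Team n) → s ⊆ t ⊎ ∃ λ v → s v ≡ true × t v ≡ false
  ⊆-or-witness s t with any-valuation? (λ v → (s v ≟B true) ×-dec (t v ≟B false))
  ... | yes witness = inj₂ witness
  ... | no none = inj₁ λ v sv → ¬-not λ tv → none (v , sv , tv)

  empty-or-inhabited : (t : Team n) → (∀ v → t v ≡ false) ⊎ ∃ λ v → t v ≡ true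
  empty-or-inhabited t with any-valuation? (λ v → t v ≟B true)
  ... | yes witness = inj₂ witness
  ... | no none = inj₁ λ v → ¬-not λ tv → none (v , tv)

  ⊆-antisym : ∀ {s t : Team n} → s ⊆ t → t ⊆ s → s ≐ t
  ⊆-antisym s⊆t t⊆s v = ⇔→≡ (mk⇔ (s⊆t v) (t⊆s v))

-- Team semantics

module _ {n : ℕ} where

  ⊨-resp-≐ : ∀ {t s : Team n} (φ : Form n) → t ≐ s → t ⊨ φ → s ⊨ φ
  ⊨-resp-≐ (atom p) t≐s h v sv = h v (trans (t≐s v) sv)
  ⊨-resp-≐ falsum t≐s h v = trans (sym (t≐s v)) (h v)
  ⊨-resp-≐ (dep ps q) t≐s h v u sv su = h v u (trans (t≐s v) sv) (trans (t≐s u) su)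
  ⊨-resp-≐ (incl as bs) t≐s h v sv with h v (trans (t≐s v) sv)
  ... | u , tu , as≡bs = u , trans (sym (t≐s u)) tu , as≡bs
  ⊨-resp-≐ (neg φ) t≐s h v sv = h v (trans (t≐s v) sv)
  ⊨-resp-≐ (φ ∧f ψ) t≐s (hφ , hψ) = ⊨-resp-≐ φ t≐s hφ , ⊨-resp-≐ ψ t≐s hψ
  ⊨-resp-≐ (φ ∨f ψ) t≐s (r , q , t≐r∪q , hr , hq) =
    r , q , (λ v → trans (sym (t≐s v)) (t≐r∪q v)) , hr , hq

  emptyTeam-⊨ : (φ : Form n) → emptyTeam ⊨ φ
  emptyTeam-⊨ (atom p) v ()
  emptyTeam-⊨ falsum v = refl
  emptyTeam-⊨ (dep ps q) v u ()
  emptyTeam-⊨ (incl as bs) v ()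
  emptyTeam-⊨ (neg φ) v ()
  emptyTeam-⊨ (φ ∧f ψ) = emptyTeam-⊨ φ , emptyTeam-⊨ ψ
  emptyTeam-⊨ (φ ∨f ψ) = emptyTeam , emptyTeam , (λ v → refl) , emptyTeam-⊨ φ , emptyTeam-⊨ ψ

  empty-⊨ : ∀ {t : Team n} (φ : Form n) → (∀ v → t v ≡ false) → t ⊨ φ
  empty-⊨ φ t-empty = ⊨-resp-≐ φ (λ v → sym (t-empty v)) (emptyTeam-⊨ φ)

  ∨f-introˡ : ∀ {t : Team n} φ ψ → t ⊨ φ → t ⊨ (φ ∨f ψ)
  ∨f-introˡ {t} φ ψ h = t , emptyTeam , (λ v → sym (∨-identityʳ (t v))) , h , emptyTeam-⊨ ψ

  ∨f-introʳ : ∀ {t : Team n} φ ψ → t ⊨ ψ → t ⊨ (φ ∨f ψ)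
  ∨f-introʳ {t} φ ψ h = emptyTeam , t , (λ v → refl) , emptyTeam-⊨ φ , h

  verum : Form n
  verum = neg falsum

  ⊨-verum : (t : Team n) → t ⊨ verum
  ⊨-verum t v _ singleton⊨⊥ = not-¬ (singleton-self v) (singleton⊨⊥ v)

  ⋀ : List (Form n) → Form n
  ⋀ [] = verum
  ⋀ (φ ∷ φs) = φ ∧f ⋀ φs

  ⊨-⋀ : ∀ {t : Team n} {φs} → (t ⊨ ⋀ φs) ⇔ All (t ⊨_) φs
  ⊨-⋀ {t} {φs} = mk⇔ (to φs) (from φs)
    where
    to : ∀ φs → t ⊨ ⋀ φs → All (t ⊨_) φs
    to [] _ = []
    to (φ ∷ φs) (hφ , hφs) = hφ ∷ to φs hφs
    from : ∀ φs → All (t ⊨_) φs → t ⊨ ⋀ φs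
    from [] [] = ⊨-verum t
    from (φ ∷ φs) (hφ ∷ hφs) = hφ , from φs hφs

-- Formulas defining team properties

module _ {n : ℕ} where

  lit : Bool → Term n
  lit true = ttop
  lit false = tbot

  contains : Valuation n → Form n
  contains w = incl (vmap lit w) (tabulate var)

  evalT-lits : ∀ {m} (v : Valuation n) (w : Vec Bool m) → vmap (evalT v) (vmap lit w) ≡ w
  evalT-lits v w = begin
    vmap (evalT v) (vmap lit w)  ≡⟨ map-∘ (evalT v) lit w ⟨
    vmap (evalT v ∘ lit) w       ≡⟨ map-cong evalT-lit w ⟩
    vmap id w                    ≡⟨ map-id w ⟩
    w                            ∎
    where
    open ≡-Reasoning
    evalT-lit : (b : Bool) → evalT v (lit b) ≡ b
    evalT-lit true = refl
    evalT-lit false = refl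

  evalT-vars : (v : Valuation n) → vmap (evalT v) (tabulate var) ≡ v
  evalT-vars v = trans (sym (tabulate-∘ (evalT v) var)) (tabulate∘lookup v)

  contains-sound : ∀ {t : Team n} {w v} → t ⊨ contains w → t v ≡ true → t w ≡ true
  contains-sound {t} {w} {v} h tv with h v tv
  ... | u , tu , w≡u = subst (λ x → t x ≡ true) (sym w≡u′) tu
    where
    w≡u′ : w ≡ u
    w≡u′ = trans (sym (evalT-lits v w)) (trans w≡u (evalT-vars u))

  contains-complete : ∀ {t : Team n} {w} → t w ≡ true → t ⊨ contains w
  contains-complete {w = w} tw v _ = w , tw , trans (evalT-lits v w) (sym (evalT-vars w))

  meets : List (Valuation n) → Form n
  meets [] = falsum
  meets (w ∷ ws) = contains w ∨f meets ws

  meets-sound : ∀ {t : Team n} {v} ws → t ⊨ meets ws → t v ≡ true → ∃ λ w → w ∈ ws × t w ≡ true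
  meets-sound {v = v} [] h tv = contradiction (h v) (not-¬ tv)
  meets-sound {t} {v} (w ∷ ws) (r , q , t≐r∪q , hr , hq) tv
    with ∪-cases r q v (trans (sym (t≐r∪q v)) tv)
  ... | inj₁ rv = w , here refl , trans (t≐r∪q w) (⊆-∪ˡ r q w (contains-sound hr rv))
  ... | inj₂ qv with meets-sound ws hq qv
  ...   | w′ , w′∈ws , qw′ = w′ , there w′∈ws , trans (t≐r∪q w′) (⊆-∪ʳ r q w′ qw′)

  meets-complete : ∀ {t : Team n} {w ws} → w ∈ ws → t w ≡ true → t ⊨ meets ws
  meets-complete {ws = w ∷ ws} (here refl) tw =
    ∨f-introˡ (contains w) (meets ws) (contains-complete tw)
  meets-complete {ws = w ∷ ws} (there w∈ws) tw =
    ∨f-introʳ (contains w) (meets ws) (meets-complete w∈ws tw)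

  constancy : Form n
  constancy = ⋀ (map (dep []) (allFin n))

  constancy-sound : ∀ {t : Team n} → t ⊨ constancy → ∀ v u → t v ≡ true → t u ≡ true → v ≡ u
  constancy-sound h v u tv tu =
    lookup-ext λ i → All.lookup (map⁻ (Equivalence.to ⊨-⋀ h)) (∈-allFin i) v u tv tu []

  constancy-complete : ∀ {t : Team n} → (∀ v u → t v ≡ true → t u ≡ true → v ≡ u) → t ⊨ constancy
  constancy-complete t-const = Equivalence.from ⊨-⋀ (map⁺ (All.tabulate λ {i} _ v u tv tu _ →
    cong (λ w → lookup w i) (t-const v u tv tu)))

  atMost : ℕ → Form n
  atMost zero = falsum
  atMost (suc k) = constancy ∨f atMost k

  size : Team n → ℕ
  size t = count t (valuations n)

  atMost-sound : ∀ {t : Team n} k → t ⊨ atMost k → size t ≤ k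
  atMost-sound {t} zero t-empty = ≤-reflexive (count-none (valuations n) λ {v} _ → t-empty v)
  atMost-sound {t} (suc k) (r , q , t≐r∪q , hr , hq) = ≤-trans
    (count-∪ (λ v tv → trans (sym (t≐r∪q v)) tv) (valuations n))
    (+-mono-≤ (count-unique (valuations-unique n) (constancy-sound hr)) (atMost-sound k hq))

  atMost-complete : ∀ {t : Team n} k → size t ≤ k → t ⊨ atMost k
  atMost-complete zero size≤0 v = count-zero (n≤0⇒n≡0 size≤0) (∈-valuations v)
  atMost-complete {t} (suc k) size≤1+k with empty-or-inhabited t
  ... | inj₁ t-empty = empty-⊨ (atMost (suc k)) t-empty
  ... | inj₂ (w , tw) =
    t ∩ singleton w , t ∖ singleton w , ∩∪∖ t (singleton w) ,
    constancy-complete (λ v u tv tu → trans (in-w v tv) (sym (in-w u tu))) ,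
    atMost-complete k (≤-pred (<-≤-trans size[t∖w]<size[t] size≤1+k))
    where
    in-w : ∀ v → (t ∩ singleton w) v ≡ true → v ≡ w
    in-w v = singleton-≡ ∘ ∩-⊆ʳ t (singleton w) v
    w∉t∖w : (t ∖ singleton w) w ≡ false
    w∉t∖w = trans (cong (λ b → t w ∧ not b) (singleton-self w)) (∧-zeroʳ (t w))
    size[t∖w]<size[t] : size (t ∖ singleton w) < size t
    size[t∖w]<size[t] = count-strict (∖-⊆ t (singleton w)) (∈-valuations w) w∉t∖w tw

  outside : Team n → List (Valuation n)
  outside t₀ = filter (λ v → t₀ v ≟B false) (valuations n)

  ∈-outside⁺ : ∀ {t₀ : Team n} {w} → t₀ w ≡ false → w ∈ outside t₀
  ∈-outside⁺ {t₀} {w} = ∈-filter⁺ (λ v → t₀ v ≟B false) (∈-valuations w)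

  ∈-outside⁻ : ∀ {t₀ : Team n} {w} → w ∈ outside t₀ → t₀ w ≡ false
  ∈-outside⁻ {t₀} = proj₂ ∘ ∈-filter⁻ (λ v → t₀ v ≟B false) {xs = valuations n}

  distinguish : Team n → Form n
  distinguish t₀ = atMost (pred (size t₀)) ∨f meets (outside t₀)

  distinguish-complete : ∀ {s t₀ : Team n} → ¬ (s ≐ t₀) → s ⊨ distinguish t₀
  distinguish-complete {s} {t₀} s≉t₀ with ⊆-or-witness s t₀ | ⊆-or-witness t₀ s
  ... | inj₂ (w , sw , t₀w) | _ =
    ∨f-introʳ _ (meets (outside t₀)) (meets-complete (∈-outside⁺ t₀w) sw)
  ... | inj₁ s⊆t₀ | inj₂ (w , t₀w , sw) =
    ∨f-introˡ _ (meets (outside t₀))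
      (atMost-complete _ (<⇒≤pred (count-strict s⊆t₀ (∈-valuations w) sw t₀w)))
  ... | inj₁ s⊆t₀ | inj₁ t₀⊆s = contradiction (⊆-antisym s⊆t₀ t₀⊆s) s≉t₀

  distinguish-sound : ∀ {s t₀ : Team n} → s ≐ t₀ → s ⊨ distinguish t₀ → t₀ ≐ emptyTeam
  distinguish-sound {s} {t₀} s≐t₀ (a , c , s≐a∪c , ha , hc) v =
    count-zero (n≤pred[n]⇒n≡0 size-bound) (∈-valuations v)
    where
    c-empty : ∀ v → c v ≢ true
    c-empty v cv with meets-sound (outside t₀) hc cv
    ... | w , w∈outside , cw = not-¬ t₀w (∈-outside⁻ w∈outside)
      where
      t₀w : t₀ w ≡ true
      t₀w = trans (sym (s≐t₀ w)) (trans (s≐a∪c w) (⊆-∪ʳ a c w cw))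
    s⊆a : s ⊆ a
    s⊆a v sv with ∪-cases a c v (trans (sym (s≐a∪c v)) sv)
    ... | inj₁ av = av
    ... | inj₂ cv = contradiction cv (c-empty v)
    size-bound : size t₀ ≤ pred (size t₀)
    size-bound = ≤-trans (count-mono (λ v t₀v → trans (s≐t₀ v) t₀v) (valuations n))
      (≤-trans (count-mono s⊆a (valuations n)) (atMost-sound _ ha))

  update : Valuation n → Bool → Team n → Team n
  update x b t v = if ⌊ v ≟ᵥ x ⌋ then b else t v

  teams : List (Valuation n) → List (Team n)
  teams [] = emptyTeam ∷ []
  teams (x ∷ xs) = cartesianProductWith (update x) bools (teams xs)

  teams-complete : ∀ xs (t : Team n) → ∃ λ t₀ → t₀ ∈ teams xs × (∀ {v} → v ∈ xs → t v ≡ t₀ v)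
  teams-complete [] t = emptyTeam , here refl , λ ()
  teams-complete (x ∷ xs) t with teams-complete xs t
  ... | t₀ , t₀∈ , t≗t₀ =
    update x (t x) t₀ , ∈-cartesianProductWith⁺ (update x) (∈-bools (t x)) t₀∈ , agree
    where
    agree : ∀ {v} → v ∈ x ∷ xs → t v ≡ update x (t x) t₀ v
    agree {v} v∈ with v ≟ᵥ x | v∈
    ... | yes refl | _ = refl
    ... | no v≢x | here v≡x = contradiction v≡x v≢x
    ... | no _ | there v∈xs = t≗t₀ v∈xs

  allTeams : List (Team n)
  allTeams = teams (valuations n)

  allTeams-complete : (t : Team n) → ∃ λ t₀ → t₀ ∈ allTeams × t ≐ t₀
  allTeams-complete t with teams-complete (valuations n) t
  ... | t₀ , t₀∈ , t≗t₀ = t₀ , t₀∈ , λ v → t≗t₀ (∈-valuations v)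

module _ {n : ℕ} (T : Team n → Bool) where

  excluded? : Decidable (λ (t₀ : Team n) → T t₀ ≡ false)
  excluded? t₀ = T t₀ ≟B false

  characteristic : Form n
  characteristic = ⋀ (map distinguish (filter excluded? allTeams))

  characteristic-correct : Extensional T → T emptyTeam ≡ true →
    (t : Team n) → (t ⊨ characteristic) ⇔ (T t ≡ true)
  characteristic-correct ext T∅ t = mk⇔ sound complete
    where
    sound : t ⊨ characteristic → T t ≡ true
    sound h with allTeams-complete t
    ... | t₀ , t₀∈ , t≐t₀ with T t₀ in Tt₀
    ...   | true = trans (ext t t₀ t≐t₀) Tt₀
    ...   | false = contradiction Tt₀ (not-¬ (trans (ext t₀ emptyTeam t₀≐∅) T∅))
      where
      t₀≐∅ : t₀ ≐ emptyTeam
      t₀≐∅ = distinguish-sound t≐t₀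
        (All.lookup (map⁻ (Equivalence.to ⊨-⋀ h)) (∈-filter⁺ excluded? t₀∈ Tt₀))
    complete : T t ≡ true → t ⊨ characteristic
    complete Tt = Equivalence.from ⊨-⋀ (map⁺ (All.map
      (λ {t₀} Tt₀ → distinguish-complete λ t≐t₀ → not-¬ (trans (sym (ext t t₀ t≐t₀)) Tt) Tt₀)
      (all-filter excluded? allTeams)))

mainTheorem1 : (n : ℕ) →
  ((φ : Form n) → emptyTeam ⊨ φ) ×
  ((T : Team n → Bool) → Extensional T → T emptyTeam ≡ true →
    ∃ λ (φ : Form n) → (t : Team n) → ((t ⊨ φ) ⇔ (T t ≡ true)))
mainTheorem1 n = emptyTeam-⊨ , λ T ext T∅ → characteristic T , characteristic-correct T ext T∅
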